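{- If $\mu$ is an irreducible conjunction in a disjunctive sequent calculus $(\mathcal{L}(P),\vdash)$, then $\{\mu\}[\vdash]$ is a logical state.
   Context: A disjunctive basis is $(P,\mathcal{A}_P)$ with $P$ a set of atomic formulae and $\mathcal{A}_P$ a set of sequents $p_1,\dots,p_n\vdash\mathrm{F}$, $p_i\in P$. Formulae $\mathcal{L}(P)$ and valid sequents $\Gamma\vdash\varphi$ ($\Gamma$ finite) are generated by simultaneous transfinite induction: atoms, $\mathrm{T}$, $\mathrm{F}$ are formulae; $\phi\wedge\psi$; $\dot{\bigvee}_{i\in I}\phi_i$ whenever $\phi_i,\phi_j\vdash\mathrm{F}$ valid for all $i\ne j$. Valid sequents: members of $\mathcal{A}_P$; $\phi\vdash\phi$; $\Gamma\vdash\psi\Rightarrow\Gamma,\phi\vdash\psi$; $\Gamma\vdash\phi,\ \Delta,\phi\vdash\psi\Rightarrow\Gamma,\Delta\vdash\psi$; $\mathrm{F}\vdash\phi$; $\vdash\mathrm{T}$; $\Gamma,\phi,\psi\vdash\theta\Rightarrow\Gamma,\phi\wedge\psi\vdash\theta$; $\Gamma\vdash\phi,\ \Delta\vdash\psi\Rightarrow\Gamma,\Delta\vdash\phi\wedge\psi$; for families with $\phi_i,\phi_j\vdash\mathrm{F}$ ($i\neq j$): ($\Gamma,\phi_i\vdash\theta$ for all $i$) $\Rightarrow\Gamma,\dot{\bigvee}_i\phi_i\vdash\theta$, and $\Gamma\vdash\phi_{i_0}\Rightarrow\Gamma\vdash\dot{\bigvee}_i\phi_i$. $X[\vdash]=\{\varphi:\Gamma\vdash\varphi\text{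 valid for some finite }\Gamma\subseteq X\}$. Tautology: $\mathrm{T}\vdash\varphi$; contradiction: $\varphi\vdash\mathrm{F}$; satisfiable: neither. Conjunction: satisfiable formula built from atoms by $\wedge$ only. Flat formula: satisfiable $\dot{\bigvee}_i\mu_i$, $\mu_i$ conjunctions, $\mu_i,\mu_j\vdash\mathrm{F}$ for $i\ne j$. A conjunction $\mu$ is irreducible if whenever $\mu\vdash\dot{\bigvee}_{i\in I}\phi_i$ is valid with $\phi_i,\phi_j\vdash\mathrm{F}$ valid for all $i\ne j$, then $\mu\vdash\phi_{i_0}$ is valid for some $i_0$. A logical state is a nonempty proper subset $S\subseteq\mathcal{L}(P)$ with (S1) a flat formula $\dot{\bigvee}_i\mu_i\in S$ implies $\mu_{i_0}\in S$ for some $i_0$; (S2) $S[\vdash]\subseteq S$. -}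

module Defs where

open import Level using (Level; 0ℓ) renaming (suc to lsuc)
open import Data.List using (List; []; _∷_; _++_; map)
open import Data.List.Relation.Unary.All using (All)
open import Data.Product using (Σ; _×_; _,_; ∃)
open import Relation.Binary.PropositionalEquality using (_≡_; _≢_)
open import Relation.Nullary using (¬_)

-- A disjunctive basis (P, A_P): a set P of atomic formulae and a set A_P of
-- sequents p₁,…,pₙ ⊢ F, represented by a predicate on lists of atoms.
record DisjBasis : Set₁ where
  field
    Atom : Set
    Axiom : List Atom → Set

module Calculus (B : DisjBasis) where
  open DisjBasis B

  infixr 6 _∧_
  infix 4 _⊢_

  -- Contexts Γ are finite collections,
  -- represented by lists considered up to having the same elements.
  data Form : Set₁
  data _⊢_ : List Form → Form → Set₁

  data Form where
    atom : Atom → Form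
    T    : Form
    F    : Form
    _∧_  : Form → Form → Form
    ⋁    : (I : Set) (φ : I → Form) →
           (∀ i j → i ≢ j → (φ i ∷ φ j ∷ []) ⊢ F) → Form

  data _⊢_ where
    ax     : ∀ ps → Axiom ps → map atom ps ⊢ F
    refl⊢  : ∀ {φ} → (φ ∷ []) ⊢ φ
    -- contexts are finite sets: only the elements of Γ matter
    -- (exchange and contraction; duplication is an instance of weakening)
    exch   : ∀ Γ {Δ φ ψ θ} → (Γ ++ φ ∷ ψ ∷ Δ) ⊢ θ → (Γ ++ ψ ∷ φ ∷ Δ) ⊢ θ
    contr  : ∀ {Γ φ θ} → (φ ∷ φ ∷ Γ) ⊢ θ → (φ ∷ Γ) ⊢ θ
    weak   : ∀ {Γ φ ψ} → Γ ⊢ ψ → (φ ∷ Γ) ⊢ ψ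
    cut    : ∀ {Γ Δ φ ψ} → Γ ⊢ φ → (φ ∷ Δ) ⊢ ψ → (Γ ++ Δ) ⊢ ψ
    F⊢     : ∀ {φ} → (F ∷ []) ⊢ φ
    ⊢T     : [] ⊢ T
    ∧L     : ∀ {Γ φ ψ θ} → (φ ∷ ψ ∷ Γ) ⊢ θ → (φ ∧ ψ ∷ Γ) ⊢ θ
    ∧R     : ∀ {Γ Δ φ ψ} → Γ ⊢ φ → Δ ⊢ ψ → (Γ ++ Δ) ⊢ φ ∧ ψ
    ⋁L     : ∀ {Γ θ} (I : Set) (φ : I → Form) d →
             (∀ i → (φ i ∷ Γ) ⊢ θ) → (⋁ I φ d ∷ Γ) ⊢ θ
    ⋁R     : ∀ {Γ} (I : Set) (φ : I → Form) d (i₀ : I) →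
             Γ ⊢ φ i₀ → Γ ⊢ ⋁ I φ d

  Subset : Set₂
  Subset = Form → Set₁

  _[⊢] : Subset → Subset
  (X [⊢]) φ = Σ (List Form) λ Γ → All X Γ × (Γ ⊢ φ)

  ⟦_⟧ : Form → Subset
  ⟦ μ ⟧ φ = φ ≡ μ

  Tautology : Form → Set₁
  Tautology φ = (T ∷ []) ⊢ φ

  Contradiction : Form → Set₁
  Contradiction φ = (φ ∷ []) ⊢ F

  Satisfiable : Form → Set₁
  Satisfiable φ = ¬ Tautology φ × ¬ Contradiction φ

  data AtomConj : Form → Set₁ where
    atomC : ∀ p → AtomConj (atom p)
    ∧C    : ∀ {φ ψ} → AtomConj φ → AtomConj ψ → AtomConj (φ ∧ ψ)

  Conjunction : Form → Set₁
  Conjunction μ = AtomConj μ × Satisfiable μ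

  Flat : (I : Set) (μ : I → Form) → (∀ i j → i ≢ j → (μ i ∷ μ j ∷ []) ⊢ F) → Set₁
  Flat I μ d = Satisfiable (⋁ I μ d) × (∀ i → Conjunction (μ i))

  Irreducible : Form → Set₁
  Irreducible μ = Conjunction μ ×
    (∀ (I : Set) (φ : I → Form) d → (μ ∷ []) ⊢ ⋁ I φ d → Σ I λ i₀ → (μ ∷ []) ⊢ φ i₀)

  record LogicalState (S : Subset) : Set₂ where
    field
      nonempty : ∃ λ φ → S φ
      proper   : ∃ λ φ → ¬ S φ
      S1 : ∀ (I : Set) (μ : I → Form) d → Flat I μ d → S (⋁ I μ d) → Σ I λ i₀ → S (μ i₀)
      S2 : ∀ φ → (S [⊢]) φ → S φ

-- A formula φ lies in {μ}[⊢] exactly when μ ⊢ φ: cutting every hypothesis of Γ ⊢ φ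
-- against μ and contracting leaves μ ⊢ φ.  Hence {μ}[⊢] is deductively closed, it
-- omits F because μ is satisfiable, and it satisfies (S1) because μ is irreducible.

module Submission where

open import Defs
open import Data.List using (List; []; _∷_)
open import Data.List.Relation.Unary.All using (All; []; _∷_) renaming (map to All-map)
open import Data.Product using (_,_)
open import Relation.Binary.PropositionalEquality using (_≡_; refl)

module _ (B : DisjBasis) where
  open Calculus B

  cut-all : ∀ {μ φ} (Γ : List Form) → All (λ ψ → (μ ∷ []) ⊢ ψ) Γ →
            (μ ∷ Γ) ⊢ φ → (μ ∷ []) ⊢ φ
  cut-all []      []         μΓ⊢φ = μΓ⊢φ
  cut-all (ψ ∷ Γ) (μ⊢ψ ∷ μ⊢Γ) μψΓ⊢φ =
    cut-all Γ μ⊢Γ (contr (cut μ⊢ψ (exch [] μψΓ⊢φ)))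

  ⊢⇒singleton[⊢] : ∀ {μ φ} → (μ ∷ []) ⊢ φ → (⟦ μ ⟧ [⊢]) φ
  ⊢⇒singleton[⊢] {μ} μ⊢φ = (μ ∷ []) , (refl ∷ []) , μ⊢φ

  singleton[⊢]⇒⊢ : ∀ {μ φ} → (⟦ μ ⟧ [⊢]) φ → (μ ∷ []) ⊢ φ
  singleton[⊢]⇒⊢ {μ} (Γ , Γ≡μ , Γ⊢φ) = cut-all Γ (All-map μ⊢ Γ≡μ) (weak Γ⊢φ)
    where
    μ⊢ : ∀ {ψ} → ψ ≡ μ → (μ ∷ []) ⊢ ψ
    μ⊢ refl = refl⊢

  singleton[⊢]-closed : ∀ {μ φ} → ((⟦ μ ⟧ [⊢]) [⊢]) φ → (⟦ μ ⟧ [⊢]) φ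
  singleton[⊢]-closed (Γ , μ⊢Γ , Γ⊢φ) =
    ⊢⇒singleton[⊢] (cut-all Γ (All-map singleton[⊢]⇒⊢ μ⊢Γ) (weak Γ⊢φ))

proposition3p4 : (B : DisjBasis) → let open Calculus B in
    (μ : Form) → Irreducible μ → LogicalState (⟦ μ ⟧ [⊢])
proposition3p4 B μ ((_ , _ , μ-not-contradiction) , μ-irreducible) = record
  { nonempty = μ , ⊢⇒singleton[⊢] B refl⊢
  ; proper   = F , λ μ⊢F → μ-not-contradiction (singleton[⊢]⇒⊢ B μ⊢F)
  ; S1       = λ I μs d _ μ⊢⋁ →
      let i₀ , μ⊢μs-i₀ = μ-irreducible I μs d (singleton[⊢]⇒⊢ B μ⊢⋁)
      in  i₀ , ⊢⇒singleton[⊢] B μ⊢μs-i₀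
  ; S2       = λ _ → singleton[⊢]-closed B
  }
  where open Calculus B
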